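{- Let $s,n$ be positive integers, $0\le k\le n$, let $d\ge2$ be a divisor of $2sn+2$ and $\omega$ a primitive $d$-th root of unity. Then $$\lim_{q\to\omega}{sn+k\brack k}_{q^2}{n\brack k}_{q^2}=\begin{cases}\binom{sn+k}{k}\binom{n}{k} & \text{if } d=2,\\[2pt] \binom{\frac{sn+1+k}{d}-1}{\frac{k}{d}}\binom{\lfloor\frac{n-1}{d}\rfloor}{\frac{k}{d}} & \text{if } d\ge3 \text{ odd and } d|k,\\[2pt] \binom{\frac{2sn+2+2k}{d}-1}{\frac{2k}{d}}\binom{\lfloor\frac{2(n-1)}{d}\rfloor}{\frac{2k}{d}} & \text{if } d\ge4 \text{ even and } d|2k,\\[2pt] 0&\text{otherwise.}\end{cases}$$
   Context: ${m\brack i}_{q^2}$ denotes the Gaussian binomial coefficient ${m\brack i}_q=\frac{[m]!_q}{[i]!_q[m-i]!_q}$ with $q$ replaced by $q^2$, where $[m]_q=1+\cdots+q^{m-1}$ and $[m]!_q=[1]_q\cdots[m]_q$. -}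

module Defs where

open import Level using (Level; _⊔_)
open import Data.Nat as ℕ using (ℕ; zero; suc; _∸_; _/_; _%_; _≟_)
open import Data.Nat.Divisibility using (_∣?_)
open import Data.Nat.Combinatorics using (_C_)
open import Data.Product using (Σ; _×_)
open import Data.Empty using (⊥)
open import Relation.Nullary using (¬_; yes; no)
open import Relation.Nullary.Decidable using (_×-dec_)
open import Relation.Binary.PropositionalEquality using (_≡_)
open import Algebra.Bundles using (CommutativeRing)

record Field (c ℓ : Level) : Set (Level.suc (c ⊔ ℓ)) where
  field
    commutativeRing : CommutativeRing c ℓ
  open CommutativeRing commutativeRing public
  field
    1≉0     : ¬ (1# ≈ 0#)
    inverse : ∀ x → ¬ (x ≈ 0#) → Σ Carrier (λ y → x * y ≈ 1#)

module _ {c ℓ : Level} (K : Field c ℓ) where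
  open Field K

  pow : Carrier → ℕ → Carrier
  pow x zero    = 1#
  pow x (suc n) = x * pow x n

  fromℕ : ℕ → Carrier
  fromℕ zero    = 0#
  fromℕ (suc n) = 1# + fromℕ n

  CharZero : Set ℓ
  CharZero = ∀ n → fromℕ (suc n) ≈ 0# → ⊥


  PrimitiveRoot : ℕ → Carrier → Set ℓ
  PrimitiveRoot d ω = (pow ω d ≈ 1#) × (∀ j → 0 ℕ.< j → j ℕ.< d → ¬ (pow ω j ≈ 1#))

  -- Gaussian binomial polynomial [m brack k]_q (as a polynomial in q, via the
  -- q-Pascal rule), evaluated at q = x.
  gbin : Carrier → ℕ → ℕ → Carrier
  gbin x m       zero    = 1#
  gbin x zero    (suc k) = 0#
  gbin x (suc m) (suc k) = gbin x m k + pow x (suc k) * gbin x m (suc k)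

-- The right-hand side of Proposition 4.2 (d ≥ 2; value irrelevant for d < 2).
rhs : (s n k d : ℕ) → ℕ
rhs s n k zero = 0
rhs s n k (suc zero) = 0
rhs s n k d@(suc (suc e)) with d ≟ 2
... | yes _ = ((s ℕ.* n ℕ.+ k) C k) ℕ.* (n C k)
... | no _ with d % 2 ≟ 1 ×-dec d ∣? k
...   | yes _ = (((s ℕ.* n ℕ.+ 1 ℕ.+ k) / d ∸ 1) C (k / d)) ℕ.* (((n ∸ 1) / d) C (k / d))
...   | no _ with d % 2 ≟ 0 ×-dec d ∣? (2 ℕ.* k)
...     | yes _ = (((2 ℕ.* s ℕ.* n ℕ.+ 2 ℕ.+ 2 ℕ.* k) / d ∸ 1) C ((2 ℕ.* k) / d))
                  ℕ.* (((2 ℕ.* (n ∸ 1)) / d) C ((2 ℕ.* k) / d))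
...     | no _ = 0

{-# OPTIONS --safe #-}
module Submission where

-- Put x = ω². It is a primitive m-th root of unity, with m = d for odd d and m = d/2 for even
-- d, and at such a root the q-Lucas theorem holds: for digits a₀, b₀ < m,
-- [a₀ + a₁m, b₀ + b₁m]_x = C(a₁, b₁)·[a₀, b₀]_x, because [m, j]_x = 0 for 0 < j < m.
-- Since m ∣ sn + 1, the last digit of sn + k is m − 1 when m ∣ k, and one less than the last
-- digit r + 1 of k otherwise. In the latter case [sn + k, k]_x has the factor [r, r + 1]_x = 0;
-- in the former both factors become binomials of quotients by m, where ⌊(n − 1)/m⌋ = ⌊n/m⌋
-- because m ∤ n. For d = 2 we have x = 1 and the q-binomials are ordinary binomials.

open import Defs
open import Level using (Level)
open import Data.Nat using (ℕ; _+_; _*_; _≤_; _≟_)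
open import Data.Nat.Divisibility using (_∣_)

open import Data.Nat.Base using (zero; suc; _∸_; _<_; _%_; _/_; s≤s; z≤n; z<s; NonZero; >-nonZero)
import Data.Nat.Properties as ℕ
open import Data.Nat.Tactic.RingSolver using (solve-∀)
open import Data.Nat.DivMod
  using ( _divMod_; result; m≡m%n+[m/n]*n; m%n<n; [m+kn]%n≡m%n; m*n%n≡0
        ; m*n/n≡m; m<n⇒m/n≡0; +-distrib-/-∣ʳ; /-congʳ; m*n/m*o≡n/o)
open import Data.Nat.Divisibility
  using ( divides; _∣?_; ∣m+n∣m⇒∣n; ∣n⇒∣m*n; n∣m*n; ∣1⇒≡1; ∣⇒≤; m%n≡0⇒n∣m
        ; *-cancelʳ-∣; *-monoˡ-∣)
open import Data.Nat.Combinatorics using (_C_; nCk+nC[k+1]≡[n+1]C[k+1])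
open import Data.Fin.Base using (zero; suc)
open import Data.Product using (_,_; _×_; proj₁; proj₂; ∃-syntax; ∃₂)
open import Data.Empty using (⊥-elim)
open import Relation.Nullary using (¬_; yes; no)
open import Relation.Nullary.Decidable using (_×-dec_)
open import Relation.Binary.PropositionalEquality as ≡ using (_≡_; refl)

odd∣double⇒∣ : ∀ {d a} → d % 2 ≡ 1 → d ∣ a * 2 → d ∣ a
odd∣double⇒∣ {d} {a} d-odd d∣2a = ∣m+n∣m⇒∣n (≡.subst (d ∣_) a*d≡ (n∣m*n a)) (∣n⇒∣m*n (d / 2) d∣2a)
  where
  d≡ : d ≡ 1 + d / 2 * 2
  d≡ = ≡.trans (m≡m%n+[m/n]*n d 2) (≡.cong (_+ d / 2 * 2) d-odd)
  expand : ∀ a t → a * (1 + t * 2) ≡ t * (a * 2) + a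
  expand = solve-∀
  a*d≡ : a * d ≡ d / 2 * (a * 2) + a
  a*d≡ = ≡.trans (≡.cong (a *_) d≡) (expand a (d / 2))

[1+m]∣n+1⇒n≡m+q*[1+m] : ∀ {m n} → suc m ∣ n + 1 → ∃[ q ] n ≡ m + q * suc m
[1+m]∣n+1⇒n≡m+q*[1+m] {n = n} (divides zero eq) = ⊥-elim (ℕ.1+n≢0 (≡.trans (ℕ.+-comm 1 n) eq))
[1+m]∣n+1⇒n≡m+q*[1+m] {n = n} (divides (suc q) eq) = q , ℕ.suc-injective (≡.trans (ℕ.+-comm 1 n) eq)

[1+m]∤n⇒n≡1+r+q*[1+m] : ∀ {m n} → ¬ (suc m ∣ n) → ∃₂ λ r q → r < m × n ≡ suc r + q * suc m
[1+m]∤n⇒n≡1+r+q*[1+m] {m} {n} m∤n = digits (n % suc m) (m%n<n n (suc m)) (m≡m%n+[m/n]*n n (suc m))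
  where
  digits : ∀ r → r < suc m → n ≡ r + n / suc m * suc m → ∃₂ λ r q → r < m × n ≡ suc r + q * suc m
  digits zero    _           eq = ⊥-elim (m∤n (divides (n / suc m) eq))
  digits (suc r) (s≤s r<m) eq = r , n / suc m , r<m , eq

∣n+1⇒∤n : ∀ {m n} → 2 ≤ m → m ∣ n + 1 → ¬ (m ∣ n)
∣n+1⇒∤n 2≤m m∣n+1 m∣n = ℕ.<-irrefl (≡.sym (∣1⇒≡1 (∣m+n∣m⇒∣n m∣n+1 m∣n))) 2≤m

[r+q*m]/m≡q : ∀ {r m} q .{{_ : NonZero m}} → r < m → (r + q * m) / m ≡ q
[r+q*m]/m≡q {r} {m} q r<m =
  ≡.trans (+-distrib-/-∣ʳ r (n∣m*n q)) (≡.cong₂ _+_ (m<n⇒m/n≡0 r<m) (m*n/n≡m q m))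

2sn+2≡[sn+1]*2 : ∀ s n → 2 * s * n + 2 ≡ (s * n + 1) * 2
2sn+2≡[sn+1]*2 = solve-∀

data Modulus : ℕ → Set where
  two  : Modulus 2
  odd  : ∀ t → Modulus (3 + t * 2)
  even : ∀ t → Modulus ((2 + t) * 2)

modulus : ∀ d → 2 ≤ d → Modulus d
modulus d 2≤d with d divMod 2 | 2≤d
... | result 1             zero       refl | _ = two
... | result (suc (suc t)) zero       refl | _ = even t
... | result (suc t)       (suc zero) refl | _ = odd t
... | result zero          zero       refl | ()
... | result zero          (suc zero) refl | s≤s ()

reducedProduct : (s n k m : ℕ) .{{_ : NonZero m}} → ℕ
reducedProduct s n k m = (((s * n + 1 + k) / m ∸ 1) C (k / m)) * (((n ∸ 1) / m) C (k / m))

productAtRoot : (s n k m : ℕ) .{{_ : NonZero m}} → ℕ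
productAtRoot s n k m with m ∣? k
... | yes _ = reducedProduct s n k m
... | no  _ = 0

reducedProduct-digits : ∀ {m q r n₁} s n k₁ → s * n ≡ m + q * suc m → n ≡ suc r + n₁ * suc m → r < m →
                        reducedProduct s n (k₁ * suc m) (suc m) ≡ ((q + k₁) C k₁) * (n₁ C k₁)
reducedProduct-digits {m} {q} {r} {n₁} s n k₁ sn≡ refl r<m =
  ≡.trans (≡.cong₂ (λ A B → (A C B) * (W C B)) top (m*n/n≡m k₁ (suc m)))
          (≡.cong (λ W → ((q + k₁) C k₁) * (W C k₁)) ([r+q*m]/m≡q n₁ (ℕ.m<n⇒m<1+n r<m)))
  where
  W = (r + n₁ * suc m) / suc m
  regroup : ∀ m q k₁ → m + q * suc m + 1 + k₁ * suc m ≡ suc (q + k₁) * suc m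
  regroup = solve-∀
  top : (s * n + 1 + k₁ * suc m) / suc m ∸ 1 ≡ q + k₁
  top = ≡.cong (_∸ 1) (≡.trans (≡.cong (_/ suc m) (≡.trans (≡.cong (λ a → a + 1 + k₁ * suc m) sn≡) (regroup m q k₁)))
                               (m*n/n≡m (suc (q + k₁)) (suc m)))

rhs-odd : ∀ s n k e → (3 + e) % 2 ≡ 1 → rhs s n k (3 + e) ≡ productAtRoot s n k (3 + e)
rhs-odd s n k e d-odd with (3 + e) % 2 ≟ 1 ×-dec (3 + e) ∣? k
... | yes (_ , d∣k) with 3 + e ∣? k
...   | yes _   = refl
...   | no d∤k  = ⊥-elim (d∤k d∣k)
rhs-odd s n k e d-odd | no ¬odd∧d∣k with 3 + e ∣? k
...   | yes d∣k = ⊥-elim (¬odd∧d∣k (d-odd , d∣k))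
...   | no _ with (3 + e) % 2 ≟ 0 ×-dec (3 + e) ∣? (2 * k)
...     | yes (d-even , _) = ⊥-elim (ℕ.1+n≢0 (≡.trans (≡.sym d-odd) d-even))
...     | no _             = refl

rhs-even : ∀ s n k t → rhs s n k ((2 + t) * 2) ≡ productAtRoot s n k (2 + t)
rhs-even s n k t with ((2 + t) * 2) % 2 ≟ 1 ×-dec (2 + t) * 2 ∣? k
... | yes (d-odd , _) = ⊥-elim (ℕ.1+n≢0 (≡.trans (≡.sym d-odd) (m*n%n≡0 (2 + t) 2)))
... | no _ with ((2 + t) * 2) % 2 ≟ 0 ×-dec (2 + t) * 2 ∣? (2 * k)
...   | no ¬even∧d∣2k with 2 + t ∣? k
...     | yes m∣k = ⊥-elim (¬even∧d∣2k (m*n%n≡0 (2 + t) 2 , ≡.subst ((2 + t) * 2 ∣_) (ℕ.*-comm k 2) (*-monoˡ-∣ 2 m∣k)))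
...     | no _    = refl
rhs-even s n k t | no _ | yes (_ , d∣2k) with 2 + t ∣? k
...     | no m∤k = ⊥-elim (m∤k (*-cancelʳ-∣ 2 (≡.subst ((2 + t) * 2 ∣_) (ℕ.*-comm 2 k) d∣2k)))
...     | yes _  = ≡.trans (≡.cong₂ (λ A B → formula A B (2 * (n ∸ 1) / d)) numerator (halve k))
                           (≡.cong (formula ((s * n + 1 + k) / (2 + t)) (k / (2 + t))) (halve (n ∸ 1)))
  where
  d = (2 + t) * 2
  formula : ℕ → ℕ → ℕ → ℕ
  formula A B W = ((A ∸ 1) C B) * (W C B)
  halve : ∀ a → 2 * a / d ≡ a / (2 + t)
  halve a = ≡.trans (/-congʳ {m = 2 * a} (ℕ.*-comm (2 + t) 2)) (m*n/m*o≡n/o 2 a (2 + t))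
  double : ∀ s n k → 2 * s * n + 2 + 2 * k ≡ 2 * (s * n + 1 + k)
  double = solve-∀
  numerator : (2 * s * n + 2 + 2 * k) / d ≡ (s * n + 1 + k) / (2 + t)
  numerator = ≡.trans (≡.cong (_/ d) (double s n k)) (halve (s * n + 1 + k))

module _ {ℓ₁ ℓ₂ : Level} (K : Field ℓ₁ ℓ₂) where
  open Field K hiding (zero) renaming (refl to ≈-refl; _+_ to _⊕_; _*_ to _⊗_)
  open import Relation.Binary.Reasoning.Setoid setoid
  open import Algebra.Properties.Semiring.Exp semiring using (_^_; ^-homo-*)
  open import Algebra.Properties.CommutativeSemiring.Exp commutativeSemiring using (^-distrib-*)
  open import Algebra.Properties.Semiring.Mult semiring using (×-homo-+; ×1-homo-*) renaming (_×_ to _×ᴷ_)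
  open import Algebra.Properties.Group +-group using (x∙y⁻¹≈ε⇒x≈y)
  open import Algebra.Properties.Ring ring using ([y-z]x≈yx-zx)
  open import Algebra.Properties.CommutativeSemigroup *-commutativeSemigroup using (xy∙z≈y∙xz; x∙yz≈y∙xz)
  open import Algebra.Solver.Ring.NaturalCoefficients.Default commutativeSemiring
    using (solve; _:=_; _:+_; _:*_; con)

  pow≡^ : ∀ x n → pow K x n ≡ x ^ n
  pow≡^ x zero    = refl
  pow≡^ x (suc n) = ≡.cong (x ⊗_) (pow≡^ x n)

  pow-+ : ∀ x a b → pow K x (a + b) ≈ pow K x a ⊗ pow K x b
  pow-+ x a b rewrite pow≡^ x (a + b) | pow≡^ x a | pow≡^ x b = ^-homo-* x a b

  pow-distrib-⊗ : ∀ x y n → pow K (x ⊗ y) n ≈ pow K x n ⊗ pow K y n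
  pow-distrib-⊗ x y n rewrite pow≡^ (x ⊗ y) n | pow≡^ x n | pow≡^ y n = ^-distrib-* x y n

  fromℕ≡×1 : ∀ n → fromℕ K n ≡ n ×ᴷ 1#
  fromℕ≡×1 zero    = refl
  fromℕ≡×1 (suc n) = ≡.cong (1# ⊕_) (fromℕ≡×1 n)

  fromℕ-+ : ∀ a b → fromℕ K (a + b) ≈ fromℕ K a ⊕ fromℕ K b
  fromℕ-+ a b rewrite fromℕ≡×1 (a + b) | fromℕ≡×1 a | fromℕ≡×1 b = ×-homo-+ 1# a b

  fromℕ-* : ∀ a b → fromℕ K (a * b) ≈ fromℕ K a ⊗ fromℕ K b
  fromℕ-* a b rewrite fromℕ≡×1 (a * b) | fromℕ≡×1 a | fromℕ≡×1 b = ×1-homo-* a b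

  x⊗y≈0⇒y≈0 : ∀ {x y} → ¬ x ≈ 0# → x ⊗ y ≈ 0# → y ≈ 0#
  x⊗y≈0⇒y≈0 {x} {y} x≉0 xy≈0 = begin
    y               ≈⟨ *-identityˡ y ⟨
    1# ⊗ y          ≈⟨ *-congʳ (proj₂ (inverse x x≉0)) ⟨
    (x ⊗ x⁻¹) ⊗ y   ≈⟨ xy∙z≈y∙xz x x⁻¹ y ⟩
    x⁻¹ ⊗ (x ⊗ y)   ≈⟨ *-congˡ xy≈0 ⟩
    x⁻¹ ⊗ 0#        ≈⟨ zeroʳ x⁻¹ ⟩
    0#              ∎
    where x⁻¹ = proj₁ (inverse x x≉0)

  x⊗y≈y⇒y≈0 : ∀ {x y} → ¬ x ≈ 1# → x ⊗ y ≈ y → y ≈ 0#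
  x⊗y≈y⇒y≈0 {x} {y} x≉1 xy≈y = x⊗y≈0⇒y≈0 (λ x-1≈0 → x≉1 (x∙y⁻¹≈ε⇒x≈y x 1# x-1≈0)) (begin
    (x - 1#) ⊗ y    ≈⟨ [y-z]x≈yx-zx y x 1# ⟩
    x ⊗ y - 1# ⊗ y  ≈⟨ +-cong xy≈y (-‿cong (*-identityˡ y)) ⟩
    y - y           ≈⟨ -‿inverseʳ y ⟩
    0#              ∎)

  pow-periodic : ∀ {x m} → pow K x m ≈ 1# → ∀ r q → pow K x (r + q * m) ≈ pow K x r
  pow-periodic {x} {m} x^m≈1 r q = begin
    pow K x (r + q * m)          ≈⟨ pow-+ x r (q * m) ⟩
    pow K x r ⊗ pow K x (q * m)  ≈⟨ *-congˡ (x^[q*m]≈1 q) ⟩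
    pow K x r ⊗ 1#               ≈⟨ *-identityʳ (pow K x r) ⟩
    pow K x r                    ∎
    where
    x^[q*m]≈1 : ∀ q → pow K x (q * m) ≈ 1#
    x^[q*m]≈1 zero    = ≈-refl
    x^[q*m]≈1 (suc q) = trans (pow-+ x m (q * m)) (trans (*-cong x^m≈1 (x^[q*m]≈1 q)) (*-identityˡ 1#))

  primitive-pow≈1⇒∣ : ∀ {d ω} .{{_ : NonZero d}} → PrimitiveRoot K d ω → ∀ {a} → pow K ω a ≈ 1# → d ∣ a
  primitive-pow≈1⇒∣ {d} {ω} (ω^d≈1 , minimal) {a} ω^a≈1 =
    m%n≡0⇒n∣m a d (remainder≡0 (a % d) (m%n<n a d) ω^[a%d]≈1)
    where
    ω^[a%d]≈1 : pow K ω (a % d) ≈ 1#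
    ω^[a%d]≈1 = begin
      pow K ω (a % d)              ≈⟨ pow-periodic ω^d≈1 (a % d) (a / d) ⟨
      pow K ω (a % d + a / d * d)  ≡⟨ ≡.cong (pow K ω) (m≡m%n+[m/n]*n a d) ⟨
      pow K ω a                    ≈⟨ ω^a≈1 ⟩
      1#                           ∎
    remainder≡0 : ∀ r → r < d → pow K ω r ≈ 1# → r ≡ 0
    remainder≡0 zero    _   _      = refl
    remainder≡0 (suc r) r<d ω^r≈1 = ⊥-elim (minimal (suc r) z<s r<d ω^r≈1)

  pow-square : ∀ ω j → pow K (ω ⊗ ω) j ≈ pow K ω (j * 2)
  pow-square ω j = begin
    pow K (ω ⊗ ω) j          ≈⟨ pow-distrib-⊗ ω ω j ⟩
    pow K ω j ⊗ pow K ω j    ≈⟨ pow-+ ω j j ⟨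
    pow K ω (j + j)          ≡⟨ ≡.cong (pow K ω) (j+j≡j*2 j) ⟩
    pow K ω (j * 2)          ∎
    where
    j+j≡j*2 : ∀ j → j + j ≡ j * 2
    j+j≡j*2 = solve-∀

  square-primitive-odd : ∀ {d ω} .{{_ : NonZero d}} → d % 2 ≡ 1 → PrimitiveRoot K d ω → PrimitiveRoot K d (ω ⊗ ω)
  square-primitive-odd {d} {ω} d-odd ω-prim@(ω^d≈1 , _) = x^d≈1 , minimal
    where
    x^d≈1 : pow K (ω ⊗ ω) d ≈ 1#
    x^d≈1 = trans (pow-distrib-⊗ ω ω d) (trans (*-cong ω^d≈1 ω^d≈1) (*-identityˡ 1#))
    minimal : ∀ j → 0 < j → j < d → ¬ pow K (ω ⊗ ω) j ≈ 1#
    minimal j 0<j j<d x^j≈1 = ℕ.<⇒≱ j<d (∣⇒≤ {{>-nonZero 0<j}} d∣j)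
      where d∣j = odd∣double⇒∣ d-odd (primitive-pow≈1⇒∣ ω-prim (trans (sym (pow-square ω j)) x^j≈1))

  square-primitive-even : ∀ {m ω} → PrimitiveRoot K (m * 2) ω → PrimitiveRoot K m (ω ⊗ ω)
  square-primitive-even {m} {ω} (ω^d≈1 , minimal) = trans (pow-square ω m) ω^d≈1 , minimal′
    where
    minimal′ : ∀ j → 0 < j → j < m → ¬ pow K (ω ⊗ ω) j ≈ 1#
    minimal′ j 0<j j<m x^j≈1 =
      minimal (j * 2) (ℕ.*-monoˡ-< 2 0<j) (ℕ.*-monoˡ-< 2 j<m) (trans (sym (pow-square ω j)) x^j≈1)

  module _ (x : Carrier) where

    a<b⇒gbin≈0 : ∀ {a b} → a < b → gbin K x a b ≈ 0#
    a<b⇒gbin≈0 {zero}  {suc b} _         = ≈-refl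
    a<b⇒gbin≈0 {suc a} {suc b} (s≤s a<b) = begin
      gbin K x a b ⊕ pow K x (suc b) ⊗ gbin K x a (suc b)
        ≈⟨ +-cong (a<b⇒gbin≈0 a<b) (*-congˡ (a<b⇒gbin≈0 (ℕ.m<n⇒m<1+n a<b))) ⟩
      0# ⊕ pow K x (suc b) ⊗ 0#  ≈⟨ +-identityˡ _ ⟩
      pow K x (suc b) ⊗ 0#       ≈⟨ zeroʳ _ ⟩
      0#                         ∎

    gbin[n,n]≈1 : ∀ n → gbin K x n n ≈ 1#
    gbin[n,n]≈1 zero    = ≈-refl
    gbin[n,n]≈1 (suc n) = begin
      gbin K x n n ⊕ pow K x (suc n) ⊗ gbin K x n (suc n)
        ≈⟨ +-cong (gbin[n,n]≈1 n) (*-congˡ (a<b⇒gbin≈0 (ℕ.n<1+n n))) ⟩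
      1# ⊕ pow K x (suc n) ⊗ 0#  ≈⟨ +-congˡ (zeroʳ _) ⟩
      1# ⊕ 0#                    ≈⟨ +-identityʳ 1# ⟩
      1#                         ∎

    gbin-pascal′ : ∀ t b → gbin K x (suc (b + t)) (suc b) ≈ pow K x t ⊗ gbin K x (b + t) b ⊕ gbin K x (b + t) (suc b)
    gbin-pascal′ zero b rewrite ℕ.+-identityʳ b = begin
      gbin K x (suc b) (suc b)          ≈⟨ gbin[n,n]≈1 (suc b) ⟩
      1#                                ≈⟨ trans (+-identityʳ _) (*-identityˡ 1#) ⟨
      1# ⊗ 1# ⊕ 0#                      ≈⟨ +-cong (*-congˡ (gbin[n,n]≈1 b)) (a<b⇒gbin≈0 (ℕ.n<1+n b)) ⟨
      1# ⊗ gbin K x b b ⊕ gbin K x b (suc b) ∎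
    gbin-pascal′ (suc t) zero = begin
      1# ⊕ (x ⊗ 1#) ⊗ gbin K x (suc t) 1
        ≈⟨ +-congˡ (*-congˡ (gbin-pascal′ t zero)) ⟩
      1# ⊕ (x ⊗ 1#) ⊗ (pow K x t ⊗ 1# ⊕ gbin K x t 1)
        ≈⟨ solve 3 (λ x p g → con 1 :+ (x :* con 1) :* (p :* con 1 :+ g) := (x :* p) :* con 1 :+ (con 1 :+ (x :* con 1) :* g))
                 ≈-refl x (pow K x t) (gbin K x t 1) ⟩
      (x ⊗ pow K x t) ⊗ 1# ⊕ (1# ⊕ (x ⊗ 1#) ⊗ gbin K x t 1) ∎
    gbin-pascal′ (suc t) (suc b) = begin
      G (suc a) (suc b) ⊕ pow K x (suc (suc b)) ⊗ G (suc a) (suc (suc b))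
        ≈⟨ +-cong (gbin-pascal′ (suc t) b) (*-congˡ (≡.subst P (≡.sym (ℕ.+-suc b t)) (gbin-pascal′ t (suc b)))) ⟩
      (pow K x (suc t) ⊗ G a b ⊕ G a (suc b)) ⊕ pow K x (suc (suc b)) ⊗ (pow K x t ⊗ G a (suc b) ⊕ G a (suc (suc b)))
        ≈⟨ solve 6 (λ x pt pb u v w → ((x :* pt) :* u :+ v) :+ (x :* (x :* pb)) :* (pt :* v :+ w)
                                   := (x :* pt) :* (u :+ (x :* pb) :* v) :+ (v :+ (x :* (x :* pb)) :* w))
                 ≈-refl x (pow K x t) (pow K x b) (G a b) (G a (suc b)) (G a (suc (suc b))) ⟩
      pow K x (suc t) ⊗ G (suc a) (suc b) ⊕ G (suc a) (suc (suc b)) ∎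
      where
      G = gbin K x
      a = b + suc t
      P : ℕ → Set ℓ₂
      P a = G (suc a) (suc (suc b)) ≈ pow K x t ⊗ G a (suc b) ⊕ G a (suc (suc b))

    -- Multiplying the second Pascal rule by u = x^(j+1) gives the first one, so u·[m, j+1] = [m, j+1].
    pow≈1⇒gbin≈0 : ∀ {m j} → suc j ≤ m → pow K x m ≈ 1# → ¬ pow K x (suc j) ≈ 1# → gbin K x m (suc j) ≈ 0#
    pow≈1⇒gbin≈0 {j = j} j<m x^m≈1 x^[1+j]≉1 with ℕ.m≤n⇒∃[o]m+o≡n j<m
    ... | t , refl = x⊗y≈y⇒y≈0 x^[1+j]≉1 (begin
      u ⊗ G (suc (j + t)) (suc j)                          ≈⟨ *-congˡ (gbin-pascal′ t j) ⟩
      u ⊗ (pow K x t ⊗ G (j + t) j ⊕ G (j + t) (suc j))    ≈⟨ distribˡ u _ _ ⟩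
      u ⊗ (pow K x t ⊗ G (j + t) j) ⊕ u ⊗ G (j + t) (suc j) ≈⟨ +-congʳ (*-assoc u _ _) ⟨
      (u ⊗ pow K x t) ⊗ G (j + t) j ⊕ u ⊗ G (j + t) (suc j) ≈⟨ +-congʳ (*-congʳ u⊗x^t≈1) ⟩
      1# ⊗ G (j + t) j ⊕ u ⊗ G (j + t) (suc j)            ≈⟨ +-congʳ (*-identityˡ _) ⟩
      G (suc (j + t)) (suc j)                              ∎)
      where
      G = gbin K x
      u = pow K x (suc j)
      u⊗x^t≈1 : u ⊗ pow K x t ≈ 1#
      u⊗x^t≈1 = trans (sym (pow-+ x (suc j) t)) x^m≈1

    module Lucas {m′ : ℕ} (x-prim : PrimitiveRoot K (suc m′) x) where

      m : ℕ
      m = suc m′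

      G : ℕ → ℕ → Carrier
      G = gbin K x

      x^[r+q*m]≈x^r : ∀ r q → pow K x (r + q * m) ≈ pow K x r
      x^[r+q*m]≈x^r = pow-periodic (proj₁ x-prim)

      gbin[m,1+j]≈0 : ∀ {j} → j < m′ → G m (suc j) ≈ 0#
      gbin[m,1+j]≈0 {j} j<m′ =
        pow≈1⇒gbin≈0 (ℕ.m≤n⇒m≤1+n j<m′) (proj₁ x-prim) (proj₂ x-prim (suc j) z<s (s≤s j<m′))

      pascal-factor : ∀ a b {c u v p} → G a b ≈ c ⊗ u → G a (suc b) ≈ c ⊗ v → pow K x (suc b) ≈ p →
                      G (suc a) (suc b) ≈ c ⊗ (u ⊕ p ⊗ v)
      pascal-factor a b {c} {u} {v} {p} g₀ g₁ x^[1+b]≈p = begin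
        G a b ⊕ pow K x (suc b) ⊗ G a (suc b) ≈⟨ +-cong g₀ (*-cong x^[1+b]≈p g₁) ⟩
        c ⊗ u ⊕ p ⊗ (c ⊗ v)                   ≈⟨ +-congˡ (x∙yz≈y∙xz p c v) ⟩
        c ⊗ u ⊕ c ⊗ (p ⊗ v)                   ≈⟨ distribˡ c u (p ⊗ v) ⟨
        c ⊗ (u ⊕ p ⊗ v)                       ∎

      -- Digits are written a₀ + a₁ * m so that the Pascal recursion on a suc-headed index
      -- needs no rewriting: suc a₀ + a₁ * m and 0 + suc a₁ * m both reduce to a suc.
      lucas : ∀ a₁ a₀ b₁ b₀ → a₀ < m → b₀ < m → G (a₀ + a₁ * m) (b₀ + b₁ * m) ≈ fromℕ K (a₁ C b₁) ⊗ G a₀ b₀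
      lucas a₁ a₀ zero zero _ _ = sym (trans (*-identityʳ _) (+-identityʳ 1#))
      lucas zero zero b₁ (suc b₀) _ _ = sym (zeroʳ _)
      lucas zero zero (suc b₁) zero _ _ = sym (zeroˡ 1#)
      lucas a₁ (suc a₀) b₁ (suc b₀) (s≤s a₀<m′) (s≤s b₀<m′) =
        pascal-factor (a₀ + a₁ * m) (b₀ + b₁ * m)
                      (lucas a₁ a₀ b₁ b₀ (ℕ.m<n⇒m<1+n a₀<m′) (ℕ.m<n⇒m<1+n b₀<m′))
                      (lucas a₁ a₀ b₁ (suc b₀) (ℕ.m<n⇒m<1+n a₀<m′) (s≤s b₀<m′))
                      (x^[r+q*m]≈x^r (suc b₀) b₁)
      lucas a₁ (suc a₀) (suc b₁) zero (s≤s a₀<m′) _ = begin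
        G (a₀ + a₁ * m) (m′ + b₁ * m) ⊕ pow K x (suc b₁ * m) ⊗ G (a₀ + a₁ * m) (suc b₁ * m)
          ≈⟨ +-cong (lucas a₁ a₀ b₁ m′ (ℕ.m<n⇒m<1+n a₀<m′) ℕ.≤-refl)
                    (*-cong (x^[r+q*m]≈x^r 0 (suc b₁)) (lucas a₁ a₀ (suc b₁) 0 (ℕ.m<n⇒m<1+n a₀<m′) z<s)) ⟩
        c₀ ⊗ G a₀ m′ ⊕ 1# ⊗ (c₁ ⊗ 1#)  ≈⟨ +-cong (*-congˡ (a<b⇒gbin≈0 a₀<m′)) (*-identityˡ _) ⟩
        c₀ ⊗ 0# ⊕ c₁ ⊗ 1#              ≈⟨ +-congʳ (zeroʳ c₀) ⟩
        0# ⊕ c₁ ⊗ 1#                   ≈⟨ +-identityˡ _ ⟩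
        c₁ ⊗ 1#                        ∎
        where
        c₀ = fromℕ K (a₁ C b₁)
        c₁ = fromℕ K (a₁ C suc b₁)
      lucas (suc a₁) zero b₁ (suc b₀) _ (s≤s b₀<m′) = begin
        G (suc a₁ * m) (suc b₀ + b₁ * m)
          ≈⟨ pascal-factor (m′ + a₁ * m) (b₀ + b₁ * m)
                           (lucas a₁ m′ b₁ b₀ ℕ.≤-refl (ℕ.m<n⇒m<1+n b₀<m′))
                           (lucas a₁ m′ b₁ (suc b₀) ℕ.≤-refl (s≤s b₀<m′))
                           (x^[r+q*m]≈x^r (suc b₀) b₁) ⟩
        c ⊗ G m (suc b₀)  ≈⟨ *-congˡ (gbin[m,1+j]≈0 b₀<m′) ⟩
        c ⊗ 0#            ≈⟨ zeroʳ c ⟩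
        0#                ≈⟨ zeroʳ _ ⟨
        fromℕ K (suc a₁ C b₁) ⊗ 0# ∎
        where c = fromℕ K (a₁ C b₁)
      lucas (suc a₁) zero (suc b₁) zero _ _ = begin
        G (m′ + a₁ * m) (m′ + b₁ * m) ⊕ pow K x (suc b₁ * m) ⊗ G (m′ + a₁ * m) (suc b₁ * m)
          ≈⟨ +-cong (lucas a₁ m′ b₁ m′ ℕ.≤-refl ℕ.≤-refl)
                    (*-cong (x^[r+q*m]≈x^r 0 (suc b₁)) (lucas a₁ m′ (suc b₁) 0 ℕ.≤-refl z<s)) ⟩
        c₀ ⊗ G m′ m′ ⊕ 1# ⊗ (c₁ ⊗ 1#)  ≈⟨ +-cong (*-congˡ (gbin[n,n]≈1 m′)) (*-identityˡ _) ⟩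
        c₀ ⊗ 1# ⊕ c₁ ⊗ 1#              ≈⟨ distribʳ 1# c₀ c₁ ⟨
        (c₀ ⊕ c₁) ⊗ 1#                 ≈⟨ *-congʳ (fromℕ-+ (a₁ C b₁) (a₁ C suc b₁)) ⟨
        fromℕ K (a₁ C b₁ + a₁ C suc b₁) ⊗ 1#
          ≡⟨ ≡.cong (λ n → fromℕ K n ⊗ 1#) (nCk+nC[k+1]≡[n+1]C[k+1] a₁ b₁) ⟩
        fromℕ K (suc a₁ C suc b₁) ⊗ 1# ∎
        where
        c₀ = fromℕ K (a₁ C b₁)
        c₁ = fromℕ K (a₁ C suc b₁)

      gbin-shifted-multiple : ∀ {M} q k₁ → M ≡ m′ + q * m → G (M + k₁ * m) (k₁ * m) ≈ fromℕ K ((q + k₁) C k₁)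
      gbin-shifted-multiple q k₁ refl = begin
        G (m′ + q * m + k₁ * m) (k₁ * m)    ≡⟨ ≡.cong (λ a → G a (k₁ * m)) regroup ⟩
        G (m′ + (q + k₁) * m) (0 + k₁ * m)  ≈⟨ lucas (q + k₁) m′ k₁ 0 ℕ.≤-refl z<s ⟩
        fromℕ K ((q + k₁) C k₁) ⊗ 1#        ≈⟨ *-identityʳ _ ⟩
        fromℕ K ((q + k₁) C k₁)             ∎
        where
        regroup : m′ + q * m + k₁ * m ≡ m′ + (q + k₁) * m
        regroup = ≡.trans (ℕ.+-assoc m′ (q * m) (k₁ * m)) (≡.cong (m′ +_) (≡.sym (ℕ.*-distribʳ-+ m q k₁)))

      gbin-shifted-non-multiple : ∀ {M} q r k₁ → M ≡ m′ + q * m → r < m′ →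
                                  G (M + (suc r + k₁ * m)) (suc r + k₁ * m) ≈ 0#
      gbin-shifted-non-multiple q r k₁ refl r<m′ = begin
        G (m′ + q * m + (suc r + k₁ * m)) (suc r + k₁ * m)
          ≡⟨ ≡.cong (λ a → G a (suc r + k₁ * m)) (regroup m′ q r k₁) ⟩
        G (r + (suc q + k₁) * m) (suc r + k₁ * m)
          ≈⟨ lucas (suc q + k₁) r k₁ (suc r) (ℕ.m<n⇒m<1+n r<m′) (s≤s r<m′) ⟩
        c ⊗ G r (suc r)  ≈⟨ *-congˡ (a<b⇒gbin≈0 (ℕ.n<1+n r)) ⟩
        c ⊗ 0#           ≈⟨ zeroʳ c ⟩
        0#               ∎
        where
        c = fromℕ K ((suc q + k₁) C k₁)
        regroup : ∀ m′ q r k₁ → m′ + q * suc m′ + (suc r + k₁ * suc m′) ≡ r + (suc q + k₁) * suc m′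
        regroup = solve-∀

      gbin-product-at-root : ∀ s n k → 1 ≤ m′ → m ∣ s * n + 1 →
                             G (s * n + k) k ⊗ G n k ≈ fromℕ K (productAtRoot s n k m)
      gbin-product-at-root s n k 1≤m′ m∣sn+1 with [1+m]∣n+1⇒n≡m+q*[1+m] m∣sn+1 | m ∣? k
      ... | q , sn≡ | no m∤k with [1+m]∤n⇒n≡1+r+q*[1+m] m∤k
      ...   | r , k₁ , r<m′ , refl = begin
        G (s * n + k) k ⊗ G n k  ≈⟨ *-congʳ (gbin-shifted-non-multiple q r k₁ sn≡ r<m′) ⟩
        0# ⊗ G n k               ≈⟨ zeroˡ _ ⟩
        0#                       ∎
      gbin-product-at-root s n k 1≤m′ m∣sn+1 | q , sn≡ | yes (divides k₁ refl)
        with [1+m]∤n⇒n≡1+r+q*[1+m] (λ m∣n → ∣n+1⇒∤n (s≤s 1≤m′) m∣sn+1 (∣n⇒∣m*n s m∣n))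
      ... | r , n₁ , r<m′ , n≡ = begin
        G (s * n + k₁ * m) (k₁ * m) ⊗ G n (k₁ * m)
          ≈⟨ *-cong (gbin-shifted-multiple q k₁ sn≡) G[n,k]≈ ⟩
        fromℕ K ((q + k₁) C k₁) ⊗ fromℕ K (n₁ C k₁)   ≈⟨ fromℕ-* ((q + k₁) C k₁) (n₁ C k₁) ⟨
        fromℕ K (((q + k₁) C k₁) * (n₁ C k₁))         ≡⟨ ≡.cong (fromℕ K) (reducedProduct-digits s n k₁ sn≡ n≡ r<m′) ⟨
        fromℕ K (reducedProduct s n (k₁ * m) m)       ∎
        where
        G[n,k]≈ : G n (k₁ * m) ≈ fromℕ K (n₁ C k₁)
        G[n,k]≈ = begin
          G n (k₁ * m)                    ≡⟨ ≡.cong (λ a → G a (k₁ * m)) n≡ ⟩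
          G (suc r + n₁ * m) (0 + k₁ * m) ≈⟨ lucas n₁ (suc r) k₁ 0 (s≤s r<m′) z<s ⟩
          fromℕ K (n₁ C k₁) ⊗ 1#          ≈⟨ *-identityʳ _ ⟩
          fromℕ K (n₁ C k₁)               ∎

    gbin≈C-at-1 : PrimitiveRoot K 1 x → ∀ a b → gbin K x a b ≈ fromℕ K (a C b)
    gbin≈C-at-1 x-prim a b = begin
      gbin K x a b              ≡⟨ ≡.cong₂ (gbin K x) (ℕ.*-identityʳ a) (ℕ.*-identityʳ b) ⟨
      gbin K x (a * 1) (b * 1)  ≈⟨ lucas a 0 b 0 z<s z<s ⟩
      fromℕ K (a C b) ⊗ 1#      ≈⟨ *-identityʳ _ ⟩
      fromℕ K (a C b)           ∎
      where open Lucas x-prim using (lucas)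

proposition4p2 : ∀ {c ℓ : Level} (K : Field c ℓ) → CharZero K →
    (s n k d : ℕ) → 1 ≤ s → 1 ≤ n → k ≤ n → 2 ≤ d → d ∣ (2 * s * n + 2) →
    (ω : Field.Carrier K) → PrimitiveRoot K d ω →
    Field._≈_ K
      (Field._*_ K (gbin K (Field._*_ K ω ω) (s * n + k) k) (gbin K (Field._*_ K ω ω) n k))
      (fromℕ K (rhs s n k d))
proposition4p2 K _ s n k d _ _ _ 2≤d d∣2sn+2 ω ω-prim
  with modulus d 2≤d | ≡.subst (d ∣_) (2sn+2≡[sn+1]*2 s n) d∣2sn+2
... | two | _ =
  trans (*-cong (gbin≈C-at-1 K x x-prim (s * n + k) k) (gbin≈C-at-1 K x x-prim n k))
        (sym (fromℕ-* K ((s * n + k) C k) (n C k)))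
  where
  open Field K using (trans; sym; *-cong)
  x = Field._*_ K ω ω
  x-prim = square-primitive-even K {1} ω-prim
... | odd t | d∣[sn+1]*2 =
  trans (gbin-product-at-root s n k (s≤s z≤n) (odd∣double⇒∣ d-odd d∣[sn+1]*2))
        (reflexive (≡.cong (fromℕ K) (≡.sym (rhs-odd s n k (t * 2) d-odd))))
  where
  open Field K using (trans; reflexive)
  d-odd = [m+kn]%n≡m%n 1 (suc t) 2
  open Lucas K (Field._*_ K ω ω) (square-primitive-odd K d-odd ω-prim) using (gbin-product-at-root)
... | even t | d∣[sn+1]*2 =
  trans (gbin-product-at-root s n k (s≤s z≤n) (*-cancelʳ-∣ 2 d∣[sn+1]*2))
        (reflexive (≡.cong (fromℕ K) (≡.sym (rhs-even s n k t))))
  where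
  open Field K using (trans; reflexive)
  open Lucas K (Field._*_ K ω ω) (square-primitive-even K {2 + t} ω-prim) using (gbin-product-at-root)
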